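{- Let $\mu\vdash n$ and $a\vDash n$ satisfy $\mu\unrhd\lambda(a)$. Then $l(\mu,a)\le s(\mu,a)$.
   Context: A composition $a=(a_1,\dots,a_h)\vDash n$ is a sequence of positive integers summing to $n$. A partition $\mu=(\mu_1,\dots,\mu_k)\vdash n$ is a non-increasing composition; $\mu_i=0$ for $i>k$, trailing zeros are deleted. For compositions $a=(a_1,\dots,a_h)$, $b=(b_1,\dots,b_k)$ of $n$, $a\unrhd b$ means $k\ge h$ and $\sum_{i=1}^j a_i\ge\sum_{i=1}^jb_i$ for $j=1,\dots,h$. $\lambda(a)$ is the non-increasing rearrangement of $a$. $\mu^{(i)}$ is $\mu$ with its $i$-th entry decreased by $1$. $\tilde a=(a_1,\dots,a_{h-1},a_h-1)$ if $a_h\ge2$, $\tilde a=(a_1,\dots,a_{h-1})$ if $a_h=1$. $s(\mu,a)=\max\{i:1\le i\le k,\ \mu_i\ge a_h\}$. $R(\mu,a)$ is the set of $i\in\{1,\dots,k\}$ with $\mu_i>\mu_{i+1}$ and $\mu^{(i)}\unrhd\lambda(\tilde a)$, and $l(\mu,a)=\min R(\mu,a)$. -}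

module Defs where

open import Data.Nat using (ℕ; zero; suc; _∸_; _≤_; _<_; _≤?_)
open import Data.List using (List; []; _∷_; length; take; foldr)
open import Data.Nat.ListAction using (sum)
open import Relation.Binary.PropositionalEquality using (_≡_)
open import Data.List.Relation.Unary.All using (All)
open import Data.Product using (_×_)
open import Relation.Nullary using (yes; no)

IsComposition : ℕ → List ℕ → Set
IsComposition n a = All (λ x → 1 ≤ x) a × sum a ≡ n

data NonIncreasing : List ℕ → Set where
  ni[]  : NonIncreasing []
  ni[x] : ∀ {x} → NonIncreasing (x ∷ [])
  ni∷   : ∀ {x y ys} → y ≤ x → NonIncreasing (y ∷ ys) → NonIncreasing (x ∷ y ∷ ys)

IsPartition : ℕ → List ℕ → Set
IsPartition n μ = IsComposition n μ × NonIncreasing μ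

_⊵_ : List ℕ → List ℕ → Set
a ⊵ b = (length a ≤ length b)
      × (∀ j → 1 ≤ j → j ≤ length a → sum (take j b) ≤ sum (take j a))

insertDesc : ℕ → List ℕ → List ℕ
insertDesc x [] = x ∷ []
insertDesc x (y ∷ ys) with y ≤? x
... | yes _ = x ∷ y ∷ ys
... | no  _ = y ∷ insertDesc x ys

sortDesc : List ℕ → List ℕ
sortDesc = foldr insertDesc []

-- 1-based entry μ_i, with μ_i = 0 for i outside 1..length μ.
entry : List ℕ → ℕ → ℕ
entry []       _             = 0
entry (x ∷ xs) zero          = 0
entry (x ∷ xs) (suc zero)    = x
entry (x ∷ xs) (suc (suc i)) = entry xs (suc i)

trimZeros : List ℕ → List ℕ
trimZeros [] = []
trimZeros (x ∷ xs) with trimZeros xs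
... | y ∷ ys = x ∷ y ∷ ys
... | [] with x
...   | zero  = []
...   | suc m = suc m ∷ []

decAt : List ℕ → ℕ → List ℕ
decAt []       _             = []
decAt (x ∷ xs) zero          = x ∷ xs
decAt (x ∷ xs) (suc zero)    = (x ∸ 1) ∷ xs
decAt (x ∷ xs) (suc (suc i)) = x ∷ decAt xs (suc i)

partMinus : List ℕ → ℕ → List ℕ
partMinus μ i = trimZeros (decAt μ i)

tildeC : List ℕ → List ℕ
tildeC [] = []
tildeC (x ∷ []) with x
... | zero        = []
... | suc zero    = []
... | suc (suc m) = suc m ∷ []
tildeC (x ∷ y ∷ ys) = x ∷ tildeC (y ∷ ys)

-- last entry a_h (0 for the empty list).
lastEntry : List ℕ → ℕ
lastEntry []           = 0
lastEntry (x ∷ [])     = x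
lastEntry (x ∷ y ∷ ys) = lastEntry (y ∷ ys)

InR : List ℕ → List ℕ → ℕ → Set
InR μ a i = (1 ≤ i) × (i ≤ length μ)
          × (entry μ (suc i) < entry μ i)
          × (partMinus μ i ⊵ sortDesc (tildeC a))

InS : List ℕ → List ℕ → ℕ → Set
InS μ a i = (1 ≤ i) × (i ≤ length μ) × (lastEntry a ≤ entry μ i)

IsMin : (ℕ → Set) → ℕ → Set
IsMin P m = P m × (∀ i → P i → m ≤ i)

IsMax : (ℕ → Set) → ℕ → Set
IsMax P m = P m × (∀ i → P i → i ≤ m)

IsL : List ℕ → List ℕ → ℕ → Set
IsL μ a = IsMin (InR μ a)

IsS : List ℕ → List ℕ → ℕ → Set
IsS μ a = IsMax (InS μ a)

-- Let c = a_h, let r be a without its last part, and let s = s(μ,a); it suffices to show s ∈ R(μ,a).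
-- Write M, Λ, T and G for the partial sums of μ, λ(a), λ(ã) and λ(r). Inserting c into λ(r) gives
-- Λ_{j+1} = max(G_{j+1}, c + G_j), and likewise T_{j+1} = max(G_{j+1}, c - 1 + G_j). Hence either
-- T_j = Λ_j - 1, or Λ_j = G_j and then Λ_{j+1} ≥ Λ_j + c. The partial sums of μ^{(s)} are M_j for
-- j < s and M_j - 1 for j ≥ s, so what must be ruled out is T_j = Λ_j = M_j for some j ≥ s. But then
-- Λ_{j+1} ≥ M_j + c > M_j + μ_{j+1} = M_{j+1}, as μ_{j+1} < c by maximality of s, contradicting μ ⊵ λ(a).
module Submission where

open import Defs
open import Data.Nat using (ℕ; zero; suc; _+_; _≤_; _<_; _≤?_; _<?_; _⊔_; z≤n; s≤s; s≤s⁻¹)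
open import Data.Nat.Properties
open import Data.Nat.Induction using (<-rec)
open import Data.List using (List; []; _∷_; length; take; _∷ʳ_; initLast; _∷ʳ′_)
open import Data.Nat.ListAction using (sum)
open import Data.Nat.ListAction.Properties using (sum-++)
open import Data.List.Relation.Unary.All as All using (All; []; _∷_)
open import Data.List.Relation.Unary.All.Properties using (∷ʳ⁻)
open import Data.Product using (Σ; ∃; _×_; _,_; proj₁; proj₂)
open import Data.Sum using (_⊎_; inj₁; inj₂)
open import Data.Empty using (⊥-elim)
open import Relation.Nullary using (Dec; yes; no; contradiction)
open import Relation.Nullary.Decidable using (_×-dec_; map′)
open import Relation.Unary using (Decidable)
open import Relation.Binary.PropositionalEquality
open import Algebra.Properties.CommutativeSemigroup +-commutativeSemigroup using (x∙yz≈y∙xz)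
open import Algebra.Properties.CommutativeSemigroup ⊔-commutativeSemigroup using (interchange; xy∙z≈xz∙y)

module _ {P : ℕ → Set} (P? : Decidable P) where

  least : ∀ {w} → P w → ∃ (IsMin P)
  least {w} = <-rec (λ w → P w → ∃ (IsMin P)) below w
    where
    below : ∀ w → (∀ {v} → v < w → P v → ∃ (IsMin P)) → P w → ∃ (IsMin P)
    below w rec Pw with anyUpTo? P? w
    ... | yes (v , v<w , Pv) = rec v<w Pv
    ... | no ¬smaller = w , Pw , λ i Pi → ≮⇒≥ (λ i<w → ¬smaller (i , i<w , Pi))

  greatest : ∀ {w} b → P w → (∀ i → P i → i < b) → ∃ (IsMax P)
  greatest zero Pw bounded = ⊥-elim (n≮0 (bounded _ Pw))
  greatest (suc b) Pw bounded with P? b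
  ... | yes Pb = b , Pb , λ i Pi → s≤s⁻¹ (bounded i Pi)
  ... | no ¬Pb = greatest b Pw λ i Pi → ≤∧≢⇒< (s≤s⁻¹ (bounded i Pi)) λ { refl → ¬Pb Pi }

prefixSum : List ℕ → ℕ → ℕ
prefixSum L j = sum (take j L)

prefixSum-[] : ∀ j → prefixSum [] j ≡ 0
prefixSum-[] zero    = refl
prefixSum-[] (suc j) = refl

prefixSum-suc : ∀ L j → prefixSum L (suc j) ≡ prefixSum L j + entry L (suc j)
prefixSum-suc []       zero    = refl
prefixSum-suc []       (suc j) = refl
prefixSum-suc (x ∷ xs) zero    = +-comm x 0
prefixSum-suc (x ∷ xs) (suc j) =
  trans (cong (x +_) (prefixSum-suc xs j)) (sym (+-assoc x (prefixSum xs j) (entry xs (suc j))))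

prefixSum-≤-suc : ∀ L j → prefixSum L j ≤ prefixSum L (suc j)
prefixSum-≤-suc L j = subst (prefixSum L j ≤_) (sym (prefixSum-suc L j)) (m≤m+n _ _)

prefixSum-≤-sum : ∀ L j → prefixSum L j ≤ sum L
prefixSum-≤-sum []       j       = ≤-reflexive (prefixSum-[] j)
prefixSum-≤-sum (x ∷ xs) zero    = z≤n
prefixSum-≤-sum (x ∷ xs) (suc j) = +-monoʳ-≤ x (prefixSum-≤-sum xs j)

prefixSum-beyond : ∀ L j → length L ≤ j → prefixSum L j ≡ sum L
prefixSum-beyond []       j       _         = prefixSum-[] j
prefixSum-beyond (x ∷ xs) (suc j) (s≤s len≤j) = cong (x +_) (prefixSum-beyond xs j len≤j)

lastEntry-≤-sum : ∀ L → lastEntry L ≤ sum L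
lastEntry-≤-sum []           = z≤n
lastEntry-≤-sum (x ∷ [])     = m≤m+n x 0
lastEntry-≤-sum (x ∷ y ∷ ys) = ≤-trans (lastEntry-≤-sum (y ∷ ys)) (m≤n+m _ x)

prefixSum+lastEntry-≤-sum : ∀ L j → j < length L → prefixSum L j + lastEntry L ≤ sum L
prefixSum+lastEntry-≤-sum (x ∷ xs)     zero    _         = lastEntry-≤-sum (x ∷ xs)
prefixSum+lastEntry-≤-sum (x ∷ y ∷ ys) (suc j) (s≤s j<len) =
  subst (_≤ x + sum (y ∷ ys)) (sym (+-assoc x (prefixSum (y ∷ ys) j) (lastEntry (y ∷ ys))))
    (+-monoʳ-≤ x (prefixSum+lastEntry-≤-sum (y ∷ ys) j j<len))

entry-pos⇒≤length : ∀ L i → 1 ≤ entry L i → i ≤ length L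
entry-pos⇒≤length (x ∷ xs) (suc zero)    _   = s≤s z≤n
entry-pos⇒≤length (x ∷ xs) (suc (suc i)) pos = s≤s (entry-pos⇒≤length xs (suc i) pos)

⊵⇒prefixSum-≤ : ∀ {x y} → x ⊵ y → sum y ≤ sum x → ∀ j → prefixSum y j ≤ prefixSum x j
⊵⇒prefixSum-≤         _         _     zero    = z≤n
⊵⇒prefixSum-≤ {x} {y} (_ , dom) sum≤ (suc j) with suc j ≤? length x
... | yes j≤len = dom (suc j) (s≤s z≤n) j≤len
... | no  j≰len = begin
  prefixSum y (suc j) ≤⟨ prefixSum-≤-sum y (suc j) ⟩
  sum y               ≤⟨ sum≤ ⟩
  sum x               ≡⟨ prefixSum-beyond x (suc j) (<⇒≤ (≰⇒> j≰len)) ⟨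
  prefixSum x (suc j) ∎
  where open ≤-Reasoning

-- When the last entry of x is positive, equal totals force the length condition of ⊵.
prefixSum-≤⇒⊵ : ∀ {x y} → (∀ j → prefixSum y j ≤ prefixSum x j) → sum x ≡ sum y →
                x ≡ [] ⊎ 1 ≤ lastEntry x → x ⊵ y
prefixSum-≤⇒⊵ {x} {y} ps≤ sum≡ last = length≤ last , λ j _ _ → ps≤ j
  where
  length≤ : x ≡ [] ⊎ 1 ≤ lastEntry x → length x ≤ length y
  length≤ (inj₁ refl)    = z≤n
  length≤ (inj₂ lastPos) = ≮⇒≥ λ y<x → <-irrefl refl (begin-strict
    prefixSum x (length y)                 <⟨ m<m+n _ lastPos ⟩
    prefixSum x (length y) + lastEntry x  ≤⟨ prefixSum+lastEntry-≤-sum x (length y) y<x ⟩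
    sum x                                 ≡⟨ sum≡ ⟩
    sum y                                 ≡⟨ prefixSum-beyond y (length y) ≤-refl ⟨
    prefixSum y (length y)                ≤⟨ ps≤ (length y) ⟩
    prefixSum x (length y)                ∎)
    where open ≤-Reasoning

_⊵?_ : ∀ x y → Dec (x ⊵ y)
x ⊵? y = (length x ≤? length y)
  ×-dec map′ fromUpTo toUpTo (allUpTo? (λ i → prefixSum y (suc i) ≤? prefixSum x (suc i)) (length x))
  where
  fromUpTo : (∀ {i} → i < length x → prefixSum y (suc i) ≤ prefixSum x (suc i)) →
             ∀ j → 1 ≤ j → j ≤ length x → prefixSum y j ≤ prefixSum x j
  fromUpTo below (suc i) _ i<len = below i<len
  toUpTo : (∀ j → 1 ≤ j → j ≤ length x → prefixSum y j ≤ prefixSum x j) →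
           ∀ {i} → i < length x → prefixSum y (suc i) ≤ prefixSum x (suc i)
  toUpTo all {i} i<len = all (suc i) (s≤s z≤n) i<len

∷-nonIncreasing : ∀ {z xs} → All (_≤ z) xs → NonIncreasing xs → NonIncreasing (z ∷ xs)
∷-nonIncreasing []       ni[] = ni[x]
∷-nonIncreasing (y≤z ∷ _) ni  = ni∷ y≤z ni

nonIncreasing-tail : ∀ {z zs} → NonIncreasing (z ∷ zs) → NonIncreasing zs
nonIncreasing-tail ni[x]      = ni[]
nonIncreasing-tail (ni∷ _ ni) = ni

nonIncreasing⇒All-≤-head : ∀ {z zs} → NonIncreasing (z ∷ zs) → All (_≤ z) zs
nonIncreasing⇒All-≤-head ni[x]         = []
nonIncreasing⇒All-≤-head (ni∷ y≤z ni) =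
  y≤z ∷ All.map (λ v≤y → ≤-trans v≤y y≤z) (nonIncreasing⇒All-≤-head ni)

insertDesc-All : ∀ {P : ℕ → Set} {y} L → P y → All P L → All P (insertDesc y L)
insertDesc-All         []       Py []         = Py ∷ []
insertDesc-All {y = y} (z ∷ zs) Py (Pz ∷ Pzs) with z ≤? y
... | yes _ = Py ∷ Pz ∷ Pzs
... | no  _ = Pz ∷ insertDesc-All zs Py Pzs

insertDesc-nonIncreasing : ∀ y {L} → NonIncreasing L → NonIncreasing (insertDesc y L)
insertDesc-nonIncreasing y ni[] = ni[x]
insertDesc-nonIncreasing y {z ∷ zs} ni with z ≤? y
... | yes z≤y = ni∷ z≤y ni
... | no  z≰y = ∷-nonIncreasing
  (insertDesc-All zs (<⇒≤ (≰⇒> z≰y)) (nonIncreasing⇒All-≤-head ni))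
  (insertDesc-nonIncreasing y (nonIncreasing-tail ni))

sortDesc-nonIncreasing : ∀ L → NonIncreasing (sortDesc L)
sortDesc-nonIncreasing []       = ni[]
sortDesc-nonIncreasing (x ∷ xs) = insertDesc-nonIncreasing x (sortDesc-nonIncreasing xs)

sum-insertDesc : ∀ y L → sum (insertDesc y L) ≡ y + sum L
sum-insertDesc y [] = refl
sum-insertDesc y (z ∷ zs) with z ≤? y
... | yes _ = refl
... | no  _ = trans (cong (z +_) (sum-insertDesc y zs)) (x∙yz≈y∙xz z y (sum zs))

sum-sortDesc : ∀ L → sum (sortDesc L) ≡ sum L
sum-sortDesc []       = refl
sum-sortDesc (x ∷ xs) = trans (sum-insertDesc x (sortDesc xs)) (cong (x +_) (sum-sortDesc xs))

prefixSum-suc-≤ : ∀ {z zs} → All (_≤ z) zs → ∀ j → prefixSum zs (suc j) ≤ z + prefixSum zs j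
prefixSum-suc-≤         []              j       = z≤n
prefixSum-suc-≤         (w≤z ∷ _)       zero    = +-monoˡ-≤ 0 w≤z
prefixSum-suc-≤ {z} {w ∷ ws} (_ ∷ ws≤z) (suc j) = begin
  w + prefixSum ws (suc j)   ≤⟨ +-monoʳ-≤ w (prefixSum-suc-≤ ws≤z j) ⟩
  w + (z + prefixSum ws j)   ≡⟨ x∙yz≈y∙xz w z (prefixSum ws j) ⟩
  z + (w + prefixSum ws j)   ∎
  where open ≤-Reasoning

prefixSum-insertDesc : ∀ y {L} → NonIncreasing L → ∀ j →
  prefixSum (insertDesc y L) (suc j) ≡ prefixSum L (suc j) ⊔ (y + prefixSum L j)
prefixSum-insertDesc y ni[] j = refl
prefixSum-insertDesc y {z ∷ zs} ni j with z ≤? y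
... | yes z≤y = sym (m≤n⇒m⊔n≡n (prefixSum-suc-≤ (nonIncreasing⇒All-≤-head (ni∷ z≤y ni)) j))
prefixSum-insertDesc y {z ∷ zs} ni zero    | no z≰y =
  sym (m≥n⇒m⊔n≡m (+-monoˡ-≤ 0 (<⇒≤ (≰⇒> z≰y))))
prefixSum-insertDesc y {z ∷ zs} ni (suc j) | no z≰y = begin
  z + prefixSum (insertDesc y zs) (suc j)                   ≡⟨ cong (z +_) (prefixSum-insertDesc y (nonIncreasing-tail ni) j) ⟩
  z + (prefixSum zs (suc j) ⊔ (y + prefixSum zs j))         ≡⟨ +-distribˡ-⊔ z _ _ ⟩
  (z + prefixSum zs (suc j)) ⊔ (z + (y + prefixSum zs j))   ≡⟨ cong ((z + prefixSum zs (suc j)) ⊔_) (x∙yz≈y∙xz z y _) ⟩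
  (z + prefixSum zs (suc j)) ⊔ (y + (z + prefixSum zs j))   ∎
  where open ≡-Reasoning

sortedPrefixSum : List ℕ → ℕ → ℕ
sortedPrefixSum L = prefixSum (sortDesc L)

sortedPrefixSum-∷ : ∀ x xs j →
  sortedPrefixSum (x ∷ xs) (suc j) ≡ sortedPrefixSum xs (suc j) ⊔ (x + sortedPrefixSum xs j)
sortedPrefixSum-∷ x xs = prefixSum-insertDesc x (sortDesc-nonIncreasing xs)

⊔-+-exchange : ∀ x y A B C →
  (A ⊔ (y + B)) ⊔ (x + (B ⊔ (y + C))) ≡ (A ⊔ (x + B)) ⊔ (y + (B ⊔ (x + C)))
⊔-+-exchange x y A B C = begin
  (A ⊔ (y + B)) ⊔ (x + (B ⊔ (y + C)))             ≡⟨ cong ((A ⊔ (y + B)) ⊔_) (+-distribˡ-⊔ x B (y + C)) ⟩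
  (A ⊔ (y + B)) ⊔ ((x + B) ⊔ (x + (y + C)))       ≡⟨ interchange A (y + B) (x + B) (x + (y + C)) ⟩
  (A ⊔ (x + B)) ⊔ ((y + B) ⊔ (x + (y + C)))       ≡⟨ cong (λ w → (A ⊔ (x + B)) ⊔ ((y + B) ⊔ w)) (x∙yz≈y∙xz x y C) ⟩
  (A ⊔ (x + B)) ⊔ ((y + B) ⊔ (y + (x + C)))       ≡⟨ cong ((A ⊔ (x + B)) ⊔_) (+-distribˡ-⊔ y B (x + C)) ⟨
  (A ⊔ (x + B)) ⊔ (y + (B ⊔ (x + C)))             ∎
  where open ≡-Reasoning

sortedPrefixSum-∷ʳ : ∀ r y j →
  sortedPrefixSum (r ∷ʳ y) (suc j) ≡ sortedPrefixSum r (suc j) ⊔ (y + sortedPrefixSum r j)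
sortedPrefixSum-∷ʳ []      y j       = refl
sortedPrefixSum-∷ʳ (x ∷ r) y zero    = begin
  sortedPrefixSum (x ∷ r ∷ʳ y) 1                   ≡⟨ sortedPrefixSum-∷ x (r ∷ʳ y) 0 ⟩
  sortedPrefixSum (r ∷ʳ y) 1 ⊔ (x + 0)             ≡⟨ cong (_⊔ (x + 0)) (sortedPrefixSum-∷ʳ r y 0) ⟩
  (sortedPrefixSum r 1 ⊔ (y + 0)) ⊔ (x + 0)        ≡⟨ xy∙z≈xz∙y (sortedPrefixSum r 1) (y + 0) (x + 0) ⟩
  (sortedPrefixSum r 1 ⊔ (x + 0)) ⊔ (y + 0)        ≡⟨ cong (_⊔ (y + 0)) (sortedPrefixSum-∷ x r 0) ⟨
  sortedPrefixSum (x ∷ r) 1 ⊔ (y + 0)              ∎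
  where open ≡-Reasoning
sortedPrefixSum-∷ʳ (x ∷ r) y (suc j) = begin
  sortedPrefixSum (x ∷ r ∷ʳ y) (suc (suc j))
    ≡⟨ sortedPrefixSum-∷ x (r ∷ʳ y) (suc j) ⟩
  sortedPrefixSum (r ∷ʳ y) (suc (suc j)) ⊔ (x + sortedPrefixSum (r ∷ʳ y) (suc j))
    ≡⟨ cong₂ (λ u v → u ⊔ (x + v)) (sortedPrefixSum-∷ʳ r y (suc j)) (sortedPrefixSum-∷ʳ r y j) ⟩
  (sortedPrefixSum r (suc (suc j)) ⊔ (y + sortedPrefixSum r (suc j)))
    ⊔ (x + (sortedPrefixSum r (suc j) ⊔ (y + sortedPrefixSum r j)))
    ≡⟨ ⊔-+-exchange x y _ _ _ ⟩
  (sortedPrefixSum r (suc (suc j)) ⊔ (x + sortedPrefixSum r (suc j)))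
    ⊔ (y + (sortedPrefixSum r (suc j) ⊔ (x + sortedPrefixSum r j)))
    ≡⟨ cong₂ (λ u v → u ⊔ (y + v)) (sortedPrefixSum-∷ x r (suc j)) (sortedPrefixSum-∷ x r j) ⟨
  sortedPrefixSum (x ∷ r) (suc (suc j)) ⊔ (y + sortedPrefixSum (x ∷ r) (suc j))
    ∎
  where open ≡-Reasoning

lastEntry-∷ʳ : ∀ r c → lastEntry (r ∷ʳ c) ≡ c
lastEntry-∷ʳ []          c = refl
lastEntry-∷ʳ (x ∷ [])    c = refl
lastEntry-∷ʳ (x ∷ y ∷ r) c = lastEntry-∷ʳ (y ∷ r) c

tildeC-∷ʳ-1 : ∀ r → tildeC (r ∷ʳ 1) ≡ r
tildeC-∷ʳ-1 []          = refl
tildeC-∷ʳ-1 (x ∷ [])    = refl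
tildeC-∷ʳ-1 (x ∷ y ∷ r) = cong (x ∷_) (tildeC-∷ʳ-1 (y ∷ r))

tildeC-∷ʳ-suc : ∀ r c → tildeC (r ∷ʳ suc (suc c)) ≡ r ∷ʳ suc c
tildeC-∷ʳ-suc []          c = refl
tildeC-∷ʳ-suc (x ∷ [])    c = refl
tildeC-∷ʳ-suc (x ∷ y ∷ r) c = cong (x ∷_) (tildeC-∷ʳ-suc (y ∷ r) c)

sum-∷ʳ : ∀ r x → sum (r ∷ʳ x) ≡ sum r + x
sum-∷ʳ r x = trans (sum-++ r (x ∷ [])) (cong (sum r +_) (+-identityʳ x))

sum-tildeC-∷ʳ : ∀ r c → sum (tildeC (r ∷ʳ suc c)) + 1 ≡ sum (r ∷ʳ suc c)
sum-tildeC-∷ʳ r zero    = trans (cong (λ t → sum t + 1) (tildeC-∷ʳ-1 r)) (sym (sum-∷ʳ r 1))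
sum-tildeC-∷ʳ r (suc c) = begin
  sum (tildeC (r ∷ʳ suc (suc c))) + 1   ≡⟨ cong (λ t → sum t + 1) (tildeC-∷ʳ-suc r c) ⟩
  sum (r ∷ʳ suc c) + 1                  ≡⟨ cong (_+ 1) (sum-∷ʳ r (suc c)) ⟩
  sum r + suc c + 1                     ≡⟨ +-assoc (sum r) (suc c) 1 ⟩
  sum r + (suc c + 1)                   ≡⟨ cong (sum r +_) (+-comm (suc c) 1) ⟩
  sum r + suc (suc c)                   ≡⟨ sum-∷ʳ r (suc (suc c)) ⟨
  sum (r ∷ʳ suc (suc c))                ∎
  where open ≡-Reasoning

sortedPrefixSum-tildeC-∷ʳ : ∀ r c j →
  sortedPrefixSum (tildeC (r ∷ʳ suc c)) (suc j) ≡ sortedPrefixSum r (suc j) ⊔ (c + sortedPrefixSum r j)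
sortedPrefixSum-tildeC-∷ʳ r zero j =
  trans (cong (λ t → sortedPrefixSum t (suc j)) (tildeC-∷ʳ-1 r))
        (sym (m≥n⇒m⊔n≡m (prefixSum-≤-suc (sortDesc r) j)))
sortedPrefixSum-tildeC-∷ʳ r (suc c) j =
  trans (cong (λ t → sortedPrefixSum t (suc j)) (tildeC-∷ʳ-suc r c)) (sortedPrefixSum-∷ʳ r (suc c) j)

⊔-suc-dichotomy : ∀ u w → suc (u ⊔ w) ≡ u ⊔ suc w ⊎ u ⊔ suc w ≡ u
⊔-suc-dichotomy u w with w <? u
... | yes w<u = inj₂ (m≥n⇒m⊔n≡m w<u)
... | no  w≮u = inj₁ (trans (cong suc (m≤n⇒m⊔n≡n (≮⇒≥ w≮u))) (sym (m≤n⇒m⊔n≡n (m≤n⇒m≤1+n (≮⇒≥ w≮u)))))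

-- The last part a_h is written suc c, so that ã ends in c (or loses its last part when c = 0).
module _ (r : List ℕ) (c : ℕ) where

  sortedPrefixSum-tildeC-≤ : ∀ j → sortedPrefixSum (tildeC (r ∷ʳ suc c)) j ≤ sortedPrefixSum (r ∷ʳ suc c) j
  sortedPrefixSum-tildeC-≤ zero    = z≤n
  sortedPrefixSum-tildeC-≤ (suc j) = subst₂ _≤_
    (sym (sortedPrefixSum-tildeC-∷ʳ r c j)) (sym (sortedPrefixSum-∷ʳ r (suc c) j))
    (⊔-monoʳ-≤ (sortedPrefixSum r (suc j)) (n≤1+n _))

  sortedPrefixSum-tildeC-dichotomy : ∀ j →
    suc (sortedPrefixSum (tildeC (r ∷ʳ suc c)) (suc j)) ≡ sortedPrefixSum (r ∷ʳ suc c) (suc j)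
    ⊎ suc c + sortedPrefixSum (r ∷ʳ suc c) (suc j) ≤ sortedPrefixSum (r ∷ʳ suc c) (suc (suc j))
  sortedPrefixSum-tildeC-dichotomy j
    with ⊔-suc-dichotomy (sortedPrefixSum r (suc j)) (c + sortedPrefixSum r j)
  ... | inj₁ lowered = inj₁ (begin
    suc (sortedPrefixSum (tildeC (r ∷ʳ suc c)) (suc j))          ≡⟨ cong suc (sortedPrefixSum-tildeC-∷ʳ r c j) ⟩
    suc (sortedPrefixSum r (suc j) ⊔ (c + sortedPrefixSum r j))   ≡⟨ lowered ⟩
    sortedPrefixSum r (suc j) ⊔ (suc c + sortedPrefixSum r j)     ≡⟨ sortedPrefixSum-∷ʳ r (suc c) j ⟨
    sortedPrefixSum (r ∷ʳ suc c) (suc j)                          ∎)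
    where open ≡-Reasoning
  ... | inj₂ unchanged = inj₂ (begin
    suc c + sortedPrefixSum (r ∷ʳ suc c) (suc j)
      ≡⟨ cong (suc c +_) (trans (sortedPrefixSum-∷ʳ r (suc c) j) unchanged) ⟩
    suc c + sortedPrefixSum r (suc j)
      ≤⟨ m≤n⊔m (sortedPrefixSum r (suc (suc j))) _ ⟩
    sortedPrefixSum r (suc (suc j)) ⊔ (suc c + sortedPrefixSum r (suc j))
      ≡⟨ sortedPrefixSum-∷ʳ r (suc c) (suc j) ⟨
    sortedPrefixSum (r ∷ʳ suc c) (suc (suc j))
      ∎)
    where open ≤-Reasoning

prefixSum-trimZeros : ∀ L j → prefixSum (trimZeros L) j ≡ prefixSum L j
prefixSum-trimZeros [] j = refl
prefixSum-trimZeros (x ∷ xs) j with trimZeros xs | prefixSum-trimZeros xs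
prefixSum-trimZeros (x ∷ xs) zero    | y ∷ ys | _  = refl
prefixSum-trimZeros (x ∷ xs) (suc j) | y ∷ ys | ih = cong (x +_) (ih j)
prefixSum-trimZeros (x ∷ xs) j       | []     | ih with x
prefixSum-trimZeros (x ∷ xs) zero    | [] | ih | zero  = refl
prefixSum-trimZeros (x ∷ xs) (suc j) | [] | ih | zero  = trans (sym (prefixSum-[] j)) (ih j)
prefixSum-trimZeros (x ∷ xs) zero    | [] | ih | suc m = refl
prefixSum-trimZeros (x ∷ xs) (suc j) | [] | ih | suc m = cong (suc m +_) (ih j)

trimZeros-lastEntry : ∀ L → trimZeros L ≡ [] ⊎ 1 ≤ lastEntry (trimZeros L)
trimZeros-lastEntry [] = inj₁ refl
trimZeros-lastEntry (x ∷ xs) with trimZeros xs | trimZeros-lastEntry xs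
... | y ∷ ys | inj₂ lastPos = inj₂ lastPos
... | [] | _ with x
...   | zero  = inj₁ refl
...   | suc m = inj₂ (s≤s z≤n)

prefixSum-decAt-< : ∀ L i j → j < i → prefixSum (decAt L i) j ≡ prefixSum L j
prefixSum-decAt-< []       i             j       _         = refl
prefixSum-decAt-< (x ∷ xs) i             zero    _         = refl
prefixSum-decAt-< (x ∷ xs) (suc (suc i)) (suc j) (s≤s j<i) = cong (x +_) (prefixSum-decAt-< xs (suc i) j j<i)

prefixSum-decAt-≥ : ∀ L i j → 1 ≤ i → i ≤ j → 1 ≤ entry L i → prefixSum (decAt L i) j + 1 ≡ prefixSum L j
prefixSum-decAt-≥ (suc x ∷ xs) (suc zero)    (suc j) _ _         _   = +-comm (x + prefixSum xs j) 1
prefixSum-decAt-≥ (x ∷ xs)     (suc (suc i)) (suc j) _ (s≤s i≤j) pos =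
  trans (+-assoc x (prefixSum (decAt xs (suc i)) j) 1) (cong (x +_) (prefixSum-decAt-≥ xs (suc i) j (s≤s z≤n) i≤j pos))

sum-partMinus : ∀ L i → 1 ≤ i → 1 ≤ entry L i → sum (partMinus L i) + 1 ≡ sum L
sum-partMinus L i 1≤i pos = begin
  sum (partMinus L i) + 1                ≡⟨ cong (_+ 1) (prefixSum-beyond (partMinus L i) far (m≤m+n _ _)) ⟨
  prefixSum (partMinus L i) far + 1      ≡⟨ cong (_+ 1) (prefixSum-trimZeros (decAt L i) far) ⟩
  prefixSum (decAt L i) far + 1          ≡⟨ prefixSum-decAt-≥ L i far 1≤i (≤-trans (entry-pos⇒≤length L i pos) (m≤n+m _ _)) pos ⟩
  prefixSum L far                        ≡⟨ prefixSum-beyond L far (m≤n+m _ _) ⟩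
  sum L                                  ∎
  where
  open ≡-Reasoning
  far : ℕ
  far = length (partMinus L i) + length L

InS? : ∀ μ a → Decidable (InS μ a)
InS? μ a i = (1 ≤? i) ×-dec (i ≤? length μ) ×-dec (lastEntry a ≤? entry μ i)

InR? : ∀ μ a → Decidable (InR μ a)
InR? μ a i = (1 ≤? i) ×-dec (i ≤? length μ) ×-dec (entry μ (suc i) <? entry μ i)
  ×-dec (partMinus μ i ⊵? sortDesc (tildeC a))

module _ (μ r : List ℕ) (c : ℕ) (μ⊵λa : μ ⊵ sortDesc (r ∷ʳ suc c)) (sum≡ : sum μ ≡ sum (r ∷ʳ suc c)) where
  private
    a : List ℕ
    a = r ∷ʳ suc c

  sortedPrefixSum-≤-prefixSum : ∀ j → sortedPrefixSum a j ≤ prefixSum μ j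
  sortedPrefixSum-≤-prefixSum = ⊵⇒prefixSum-≤ μ⊵λa (≤-reflexive (trans (sum-sortDesc a) (sym sum≡)))

  InS-lastEntry : ∀ {i} → 1 ≤ i → suc c ≤ entry μ i → InS μ a i
  InS-lastEntry {i} 1≤i c<μi =
    1≤i , entry-pos⇒≤length μ i (≤-trans (s≤s z≤n) c<μi) , subst (_≤ entry μ i) (sym (lastEntry-∷ʳ r (suc c))) c<μi

  InS-1 : InS μ a 1
  InS-1 = InS-lastEntry (s≤s z≤n) (begin
    suc c                                       ≡⟨ +-identityʳ (suc c) ⟨
    suc c + 0                                   ≤⟨ m≤n⊔m (sortedPrefixSum r 1) (suc c + 0) ⟩
    sortedPrefixSum r 1 ⊔ (suc c + 0)           ≡⟨ sortedPrefixSum-∷ʳ r (suc c) 0 ⟨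
    sortedPrefixSum a 1                         ≤⟨ sortedPrefixSum-≤-prefixSum 1 ⟩
    prefixSum μ 1                               ≡⟨ prefixSum-suc μ 0 ⟩
    entry μ 1                                   ∎)
    where open ≤-Reasoning

  module _ {s : ℕ} (s-max : IsS μ a s) where

    entry-after-s-< : ∀ j → s ≤ j → entry μ (suc j) < suc c
    entry-after-s-< j s≤j = ≰⇒> λ c<μj+1 →
      <-irrefl refl (≤-trans (s≤s s≤j) (proj₂ s-max (suc j) (InS-lastEntry (s≤s z≤n) c<μj+1)))

    sortedPrefixSum-tildeC-<-from-s : ∀ j → s ≤ j → sortedPrefixSum (tildeC a) j < prefixSum μ j
    sortedPrefixSum-tildeC-<-from-s zero s≤0 = contradiction (≤-trans (proj₁ (proj₁ s-max)) s≤0) λ ()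
    sortedPrefixSum-tildeC-<-from-s (suc j) s≤j+1 with sortedPrefixSum-tildeC-dichotomy r c j
    ... | inj₁ lowered = ≤-trans (≤-reflexive lowered) (sortedPrefixSum-≤-prefixSum (suc j))
    ... | inj₂ jumps with sortedPrefixSum a (suc j) <? prefixSum μ (suc j)
    ...   | yes Λ<M = ≤-<-trans (sortedPrefixSum-tildeC-≤ r c (suc j)) Λ<M
    ...   | no  Λ≮M = contradiction (begin-strict
      suc c + prefixSum μ (suc j)                   ≡⟨ cong (suc c +_) Λ≡M ⟨
      suc c + sortedPrefixSum a (suc j)             ≤⟨ jumps ⟩
      sortedPrefixSum a (suc (suc j))               ≤⟨ sortedPrefixSum-≤-prefixSum (suc (suc j)) ⟩
      prefixSum μ (suc (suc j))                     ≡⟨ prefixSum-suc μ (suc j) ⟩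
      prefixSum μ (suc j) + entry μ (suc (suc j))   <⟨ +-monoʳ-< _ (entry-after-s-< (suc j) s≤j+1) ⟩
      prefixSum μ (suc j) + suc c                   ≡⟨ +-comm _ (suc c) ⟩
      suc c + prefixSum μ (suc j)                   ∎) (<-irrefl refl)
      where
      open ≤-Reasoning
      Λ≡M : sortedPrefixSum a (suc j) ≡ prefixSum μ (suc j)
      Λ≡M = ≤-antisym (sortedPrefixSum-≤-prefixSum (suc j)) (≮⇒≥ Λ≮M)

    entry-s-> : c < entry μ s
    entry-s-> = subst (_≤ entry μ s) (lastEntry-∷ʳ r (suc c)) (proj₂ (proj₂ (proj₁ s-max)))

    1≤entry-s : 1 ≤ entry μ s
    1≤entry-s = ≤-trans (s≤s z≤n) entry-s->

    partMinus-⊵ : partMinus μ s ⊵ sortDesc (tildeC a)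
    partMinus-⊵ = prefixSum-≤⇒⊵ tildeC≤partMinus sum-partMinus≡ (trimZeros-lastEntry (decAt μ s))
      where
      1≤s : 1 ≤ s
      1≤s = proj₁ (proj₁ s-max)
      tildeC≤decAt : ∀ j → sortedPrefixSum (tildeC a) j ≤ prefixSum (decAt μ s) j
      tildeC≤decAt j with j <? s
      ... | yes j<s = begin
        sortedPrefixSum (tildeC a) j   ≤⟨ sortedPrefixSum-tildeC-≤ r c j ⟩
        sortedPrefixSum a j            ≤⟨ sortedPrefixSum-≤-prefixSum j ⟩
        prefixSum μ j                  ≡⟨ prefixSum-decAt-< μ s j j<s ⟨
        prefixSum (decAt μ s) j        ∎
        where open ≤-Reasoning
      ... | no  j≮s = s≤s⁻¹ (begin
        suc (sortedPrefixSum (tildeC a) j)   ≤⟨ sortedPrefixSum-tildeC-<-from-s j (≮⇒≥ j≮s) ⟩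
        prefixSum μ j                        ≡⟨ prefixSum-decAt-≥ μ s j 1≤s (≮⇒≥ j≮s) 1≤entry-s ⟨
        prefixSum (decAt μ s) j + 1          ≡⟨ +-comm _ 1 ⟩
        suc (prefixSum (decAt μ s) j)        ∎)
        where open ≤-Reasoning
      tildeC≤partMinus : ∀ j → sortedPrefixSum (tildeC a) j ≤ prefixSum (partMinus μ s) j
      tildeC≤partMinus j = subst (_ ≤_) (sym (prefixSum-trimZeros (decAt μ s) j)) (tildeC≤decAt j)
      sum-partMinus≡ : sum (partMinus μ s) ≡ sum (sortDesc (tildeC a))
      sum-partMinus≡ = +-cancelʳ-≡ 1 _ _ (begin
        sum (partMinus μ s) + 1         ≡⟨ sum-partMinus μ s 1≤s 1≤entry-s ⟩
        sum μ                           ≡⟨ sum≡ ⟩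
        sum a                           ≡⟨ sum-tildeC-∷ʳ r c ⟨
        sum (tildeC a) + 1              ≡⟨ cong (_+ 1) (sum-sortDesc (tildeC a)) ⟨
        sum (sortDesc (tildeC a)) + 1   ∎)
        where open ≡-Reasoning

    InR-s : InR μ a s
    InR-s = proj₁ (proj₁ s-max) , proj₁ (proj₂ (proj₁ s-max))
      , <-≤-trans (entry-after-s-< s ≤-refl) entry-s->
      , partMinus-⊵

  l≤s : Σ ℕ (λ l → Σ ℕ (λ s → IsL μ a l × IsS μ a s × l ≤ s))
  l≤s with greatest (InS? μ a) (suc (length μ)) InS-1 (λ i Si → s≤s (proj₁ (proj₂ Si)))
  ... | s , s-max with least (InR? μ a) (InR-s s-max)
  ... | l , l-min = l , s , l-min , s-max , proj₂ l-min s (InR-s s-max)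

lemma2p5 : (n : ℕ) → 1 ≤ n → (μ a : List ℕ) → IsPartition n μ → IsComposition n a →
    μ ⊵ sortDesc a →
    Σ ℕ (λ l → Σ ℕ (λ s → IsL μ a l × IsS μ a s × l ≤ s))
lemma2p5 n 1≤n μ a ((_ , sum-μ) , _) (a-pos , sum-a) μ⊵λa with initLast a
... | [] = contradiction (subst (1 ≤_) (sym sum-a) 1≤n) λ ()
... | r ∷ʳ′ x with ∷ʳ⁻ a-pos
...   | _ , s≤s {n = c} z≤n = l≤s μ r c μ⊵λa (trans sum-μ (sym sum-a))
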